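{- Let $v\ge 2$. Suppose $M=M_1+M_2$, where $M$ is the incidence matrix of a symmetric $(v,k,\lambda)$ design and $M_i$ is the incidence matrix of a symmetric $(v,k_i,\lambda_i)$ design ($i=1,2$), and set $\alpha=\frac{2k_1k_2}{v-1}$. Let $Q=M_1M_2^{\top}+I_v$. Then $QQ^{\top}=\sigma I_v+\tau J_v$, where \[\sigma=(k_1-\lambda_1)(k_2-\lambda_2)-\alpha+1,\qquad \tau=v\lambda_1\lambda_2+\lambda_2(k_1-\lambda_1)+\lambda_1(k_2-\lambda_2)+\alpha.\]
   Context: A symmetric $(v,k,\lambda)$ design has as incidence matrix a $v\times v$ matrix $M$ with entries in $\{0,1\}$, every row and every column containing exactly $k$ ones, such that $MM^{\top}=M^{\top}M=(k-\lambda)I_v+\lambda J_v$, where $I_v$ is the identity and $J_v$ the all-ones $v\times v$ matrix. -}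

module Defs where

open import Data.Nat using (ℕ; zero; suc)
open import Data.Fin using (Fin; zero; suc; _≟_)
open import Data.Integer using (ℤ; +_; _+_; _*_; _-_)
open import Relation.Nullary using (does)
open import Data.Bool using (if_then_else_)
open import Data.Product using (_×_)
open import Data.Sum using (_⊎_)
open import Relation.Binary.PropositionalEquality using (_≡_)

Matrix : ℕ → Set
Matrix v = Fin v → Fin v → ℤ

sumFin : (n : ℕ) → (Fin n → ℤ) → ℤ
sumFin zero    f = + 0
sumFin (suc n) f = f zero + sumFin n (λ i → f (suc i))

_ᵀ : ∀ {v} → Matrix v → Matrix v
(A ᵀ) i j = A j i

_⊗_ : ∀ {v} → Matrix v → Matrix v → Matrix v
_⊗_ {v} A B i j = sumFin v (λ t → A i t * B t j)

_⊕_ : ∀ {v} → Matrix v → Matrix v → Matrix v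
(A ⊕ B) i j = A i j + B i j

I : ∀ v → Matrix v
I v i j = if does (i ≟ j) then + 1 else + 0

J : ∀ v → Matrix v
J v i j = + 1

_·_ : ∀ {v} → ℤ → Matrix v → Matrix v
(c · A) i j = c * A i j

_≋_ : ∀ {v} → Matrix v → Matrix v → Set
A ≋ B = ∀ i j → A i j ≡ B i j

record IsSymmetricDesign (v k l : ℕ) (M : Matrix v) : Set where
  field
    zeroOne : ∀ i j → (M i j ≡ + 0) ⊎ (M i j ≡ + 1)
    rowSum  : ∀ i → sumFin v (λ j → M i j) ≡ + k
    colSum  : ∀ j → sumFin v (λ i → M i j) ≡ + k
    MMᵀ     : (M ⊗ (M ᵀ)) ≋ ((((+ k) - (+ l)) · I v) ⊕ ((+ l) · J v))
    MᵀM     : ((M ᵀ) ⊗ M) ≋ ((((+ k) - (+ l)) · I v) ⊕ ((+ l) · J v))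

module Submission where

-- Put A = M₁M₂ᵀ, so that QQᵀ = AAᵀ + (A + Aᵀ) + I. Since M₂ᵀM₂ and M₁M₁ᵀ are
-- combinations of I and J, and a design absorbs J (M₁J = k₁J), the product
-- AAᵀ = M₁(M₂ᵀM₂)M₁ᵀ is an explicit combination of I and J. Expanding
-- MMᵀ = (M₁ + M₂)(M₁ + M₂)ᵀ gives A + Aᵀ = dI + cJ. As M is a 0/1 matrix,
-- M₁ and M₂ have disjoint supports, so A has zero diagonal and d = -c; the
-- row sums of A + Aᵀ are 2k₁k₂ = d + vc, hence c(v - 1) = 2k₁k₂ and c = α.

open import Defs
open import Data.Nat using (ℕ; zero; suc; _≤_; s≤s; z≤n)
open import Data.Fin using (Fin; zero; suc; fromℕ<)
open import Data.Integer using (ℤ; +_; -_; _+_; _*_; _-_)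
open import Data.Integer.Properties
  using ( +-*-semiring; +-identityˡ; +-identityʳ; *-comm; *-assoc; *-identityˡ; *-identityʳ
        ; *-zeroʳ; *-distribˡ-+; *-distribʳ-+; *-cancelʳ-≡)
open import Data.Integer.Tactic.RingSolver using (solve-∀)
open import Algebra.Properties.Semiring.Sum +-*-semiring
  using (sum; sum-cong-≗; ∑-distrib-+; ∑-comm; *-distribˡ-sum; *-distribʳ-sum)
open import Data.Product using (_×_; _,_; proj₁; proj₂)
open import Data.Sum using (_⊎_; inj₁; inj₂)
open import Function using (_∘_)
open import Relation.Binary.Bundles using (Setoid)
import Relation.Binary.Reasoning.Setoid as SetoidReasoning
open import Relation.Binary.PropositionalEquality
  using (_≡_; refl; sym; trans; cong; cong₂; subst; module ≡-Reasoning)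

sumFin≡sum : ∀ n (f : Fin n → ℤ) → sumFin n f ≡ sum f
sumFin≡sum zero    f = refl
sumFin≡sum (suc n) f = cong (_+_ (f zero)) (sumFin≡sum n (f ∘ suc))

sumFin-cong : ∀ n {f g : Fin n → ℤ} → (∀ i → f i ≡ g i) → sumFin n f ≡ sumFin n g
sumFin-cong n {f} {g} f≗g = begin
  sumFin n f ≡⟨ sumFin≡sum n f ⟩
  sum f      ≡⟨ sum-cong-≗ f≗g ⟩
  sum g      ≡⟨ sym (sumFin≡sum n g) ⟩
  sumFin n g ∎
  where open ≡-Reasoning

sumFin-distrib-+ : ∀ n (f g : Fin n → ℤ) →
  sumFin n (λ i → f i + g i) ≡ sumFin n f + sumFin n g
sumFin-distrib-+ n f g = begin
  sumFin n (λ i → f i + g i) ≡⟨ sumFin≡sum n _ ⟩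
  sum (λ i → f i + g i)      ≡⟨ ∑-distrib-+ f g ⟩
  sum f + sum g              ≡⟨ sym (cong₂ _+_ (sumFin≡sum n f) (sumFin≡sum n g)) ⟩
  sumFin n f + sumFin n g    ∎
  where open ≡-Reasoning

*-distribˡ-sumFin : ∀ n c (f : Fin n → ℤ) → c * sumFin n f ≡ sumFin n (λ i → c * f i)
*-distribˡ-sumFin n c f = begin
  c * sumFin n f             ≡⟨ cong (c *_) (sumFin≡sum n f) ⟩
  c * sum f                  ≡⟨ *-distribˡ-sum c f ⟩
  sum (λ i → c * f i)        ≡⟨ sym (sumFin≡sum n _) ⟩
  sumFin n (λ i → c * f i)   ∎
  where open ≡-Reasoning

*-distribʳ-sumFin : ∀ n c (f : Fin n → ℤ) → sumFin n f * c ≡ sumFin n (λ i → f i * c)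
*-distribʳ-sumFin n c f = begin
  sumFin n f * c             ≡⟨ cong (_* c) (sumFin≡sum n f) ⟩
  sum f * c                  ≡⟨ *-distribʳ-sum c f ⟩
  sum (λ i → f i * c)        ≡⟨ sym (sumFin≡sum n _) ⟩
  sumFin n (λ i → f i * c)   ∎
  where open ≡-Reasoning

sumFin-comm : ∀ m n (f : Fin m → Fin n → ℤ) →
  sumFin m (λ i → sumFin n (f i)) ≡ sumFin n (λ j → sumFin m (λ i → f i j))
sumFin-comm m n f = begin
  sumFin m (λ i → sumFin n (f i))          ≡⟨ sumFin≡sum m _ ⟩
  sum (λ i → sumFin n (f i))               ≡⟨ sum-cong-≗ (λ i → sumFin≡sum n (f i)) ⟩
  sum (λ i → sum (f i))                    ≡⟨ ∑-comm f ⟩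
  sum (λ j → sum (λ i → f i j))            ≡⟨ sum-cong-≗ (λ j → sym (sumFin≡sum m (λ i → f i j))) ⟩
  sum (λ j → sumFin m (λ i → f i j))       ≡⟨ sym (sumFin≡sum n _) ⟩
  sumFin n (λ j → sumFin m (λ i → f i j))  ∎
  where open ≡-Reasoning

sumFin-const : ∀ n c → sumFin n (λ _ → c) ≡ + n * c
sumFin-const zero    c = refl
sumFin-const (suc n) c = trans (cong (_+_ c) (sumFin-const n c)) (c+m*c≡[1+m]*c c (+ n))
  where
  c+m*c≡[1+m]*c : ∀ c m → c + m * c ≡ (+ 1 + m) * c
  c+m*c≡[1+m]*c = solve-∀

sumFin-zero : ∀ n → sumFin n (λ _ → + 0) ≡ + 0
sumFin-zero n = trans (sumFin-const n (+ 0)) (*-zeroʳ (+ n))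

I-sym : ∀ n (i j : Fin n) → I n i j ≡ I n j i
I-sym (suc n) zero    zero    = refl
I-sym (suc n) zero    (suc j) = refl
I-sym (suc n) (suc i) zero    = refl
I-sym (suc n) (suc i) (suc j) = I-sym n i j

I-diag : ∀ n (i : Fin n) → I n i i ≡ + 1
I-diag (suc n) zero    = refl
I-diag (suc n) (suc i) = I-diag n i

sumFin-*-Iʳ : ∀ n (f : Fin n → ℤ) j → sumFin n (λ t → f t * I n t j) ≡ f j
sumFin-*-Iʳ (suc n) f zero = begin
  f zero * + 1 + sumFin n (λ t → f (suc t) * + 0)
    ≡⟨ cong₂ _+_ (*-identityʳ (f zero))
                 (trans (sumFin-cong n (λ t → *-zeroʳ (f (suc t)))) (sumFin-zero n)) ⟩
  f zero + + 0       ≡⟨ +-identityʳ (f zero) ⟩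
  f zero             ∎
  where open ≡-Reasoning
sumFin-*-Iʳ (suc n) f (suc j) = begin
  f zero * + 0 + sumFin n (λ t → f (suc t) * I n t j)
    ≡⟨ cong₂ _+_ (*-zeroʳ (f zero)) (sumFin-*-Iʳ n (f ∘ suc) j) ⟩
  + 0 + f (suc j) ≡⟨ +-identityˡ (f (suc j)) ⟩
  f (suc j)       ∎
  where open ≡-Reasoning

sumFin-I-* : ∀ n (f : Fin n → ℤ) i → sumFin n (λ t → I n i t * f t) ≡ f i
sumFin-I-* n f i = trans (sumFin-cong n commute) (sumFin-*-Iʳ n f i)
  where
  commute : ∀ t → I n i t * f t ≡ f t * I n t i
  commute t = trans (*-comm (I n i t) (f t)) (cong (f t *_) (I-sym n i t))

module _ {v : ℕ} where

  ≋-setoid : Setoid _ _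
  ≋-setoid = record
    { Carrier       = Matrix v
    ; _≈_           = _≋_
    ; isEquivalence = record
      { refl  = λ i j → refl
      ; sym   = λ A≋B i j → sym (A≋B i j)
      ; trans = λ A≋B B≋C i j → trans (A≋B i j) (B≋C i j)
      }
    }

  open Setoid ≋-setoid public using () renaming (sym to ≋-sym; trans to ≋-trans)

  ⊕-cong : ∀ {A A′ B B′ : Matrix v} → A ≋ A′ → B ≋ B′ → (A ⊕ B) ≋ (A′ ⊕ B′)
  ⊕-cong A≋A′ B≋B′ i j = cong₂ _+_ (A≋A′ i j) (B≋B′ i j)

  -- Agda η-expands matrices during unification, so an operand that a congruence
  -- leaves unchanged cannot be inferred and is passed explicitly.
  ⊕-congˡ : ∀ (A : Matrix v) {B B′} → B ≋ B′ → (A ⊕ B) ≋ (A ⊕ B′)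
  ⊕-congˡ A = ⊕-cong (λ i j → refl {x = A i j})

  ⊕-congʳ : ∀ (B : Matrix v) {A A′} → A ≋ A′ → (A ⊕ B) ≋ (A′ ⊕ B)
  ⊕-congʳ B A≋A′ = ⊕-cong A≋A′ (λ i j → refl {x = B i j})

  ·-cong : ∀ c {A B : Matrix v} → A ≋ B → (c · A) ≋ (c · B)
  ·-cong c A≋B i j = cong (c *_) (A≋B i j)

  ·-assoc : ∀ c d (A : Matrix v) → (c · (d · A)) ≋ ((c * d) · A)
  ·-assoc c d A i j = sym (*-assoc c d (A i j))

  ⊗-cong : ∀ {A A′ B B′ : Matrix v} → A ≋ A′ → B ≋ B′ → (A ⊗ B) ≋ (A′ ⊗ B′)
  ⊗-cong A≋A′ B≋B′ i j = sumFin-cong v (λ t → cong₂ _*_ (A≋A′ i t) (B≋B′ t j))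

  ⊗-congˡ : ∀ (A : Matrix v) {B B′} → B ≋ B′ → (A ⊗ B) ≋ (A ⊗ B′)
  ⊗-congˡ A = ⊗-cong (λ i j → refl {x = A i j})

  ⊗-congʳ : ∀ (B : Matrix v) {A A′} → A ≋ A′ → (A ⊗ B) ≋ (A′ ⊗ B)
  ⊗-congʳ B A≋A′ = ⊗-cong A≋A′ (λ i j → refl {x = B i j})

  ⊗-assoc : ∀ (A B C : Matrix v) → ((A ⊗ B) ⊗ C) ≋ (A ⊗ (B ⊗ C))
  ⊗-assoc A B C i j = begin
    sumFin v (λ t → sumFin v (λ s → A i s * B s t) * C t j)
      ≡⟨ sumFin-cong v (λ t → *-distribʳ-sumFin v (C t j) _) ⟩
    sumFin v (λ t → sumFin v (λ s → A i s * B s t * C t j))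
      ≡⟨ sumFin-comm v v _ ⟩
    sumFin v (λ s → sumFin v (λ t → A i s * B s t * C t j))
      ≡⟨ sumFin-cong v (λ s → sumFin-cong v (λ t → *-assoc (A i s) (B s t) (C t j))) ⟩
    sumFin v (λ s → sumFin v (λ t → A i s * (B s t * C t j)))
      ≡⟨ sumFin-cong v (λ s → sym (*-distribˡ-sumFin v (A i s) _)) ⟩
    sumFin v (λ s → A i s * sumFin v (λ t → B s t * C t j))
      ∎
    where open ≡-Reasoning

  ⊗-distribˡ-⊕ : ∀ (A B C : Matrix v) → (A ⊗ (B ⊕ C)) ≋ ((A ⊗ B) ⊕ (A ⊗ C))
  ⊗-distribˡ-⊕ A B C i j =
    trans (sumFin-cong v (λ t → *-distribˡ-+ (A i t) (B t j) (C t j))) (sumFin-distrib-+ v _ _)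

  ⊗-distribʳ-⊕ : ∀ (A B C : Matrix v) → ((B ⊕ C) ⊗ A) ≋ ((B ⊗ A) ⊕ (C ⊗ A))
  ⊗-distribʳ-⊕ A B C i j =
    trans (sumFin-cong v (λ t → *-distribʳ-+ (A t j) (B i t) (C i t))) (sumFin-distrib-+ v _ _)

  ·-⊗-assoc : ∀ c (A B : Matrix v) → ((c · A) ⊗ B) ≋ (c · (A ⊗ B))
  ·-⊗-assoc c A B i j =
    trans (sumFin-cong v (λ t → *-assoc c (A i t) (B t j))) (sym (*-distribˡ-sumFin v c _))

  ⊗-·-comm : ∀ c (A B : Matrix v) → (A ⊗ (c · B)) ≋ (c · (A ⊗ B))
  ⊗-·-comm c A B i j =
    trans (sumFin-cong v (λ t → x*[c*y]≡c*[x*y] c (A i t) (B t j))) (sym (*-distribˡ-sumFin v c _))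
    where
    x*[c*y]≡c*[x*y] : ∀ c x y → x * (c * y) ≡ c * (x * y)
    x*[c*y]≡c*[x*y] = solve-∀

  ⊗-identityʳ : ∀ (A : Matrix v) → (A ⊗ I v) ≋ A
  ⊗-identityʳ A i j = sumFin-*-Iʳ v (A i) j

  ⊗-identityˡ : ∀ (A : Matrix v) → (I v ⊗ A) ≋ A
  ⊗-identityˡ A i j = sumFin-I-* v (λ t → A t j) i

  Iᵀ≋I : (I v ᵀ) ≋ I v
  Iᵀ≋I i j = I-sym v j i

  ᵀ-⊗ : ∀ (A B : Matrix v) → ((A ⊗ B) ᵀ) ≋ ((B ᵀ) ⊗ (A ᵀ))
  ᵀ-⊗ A B i j = sumFin-cong v (λ t → *-comm (A j t) (B t i))

  ᵀ-cong : ∀ {A B : Matrix v} → A ≋ B → (A ᵀ) ≋ (B ᵀ)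
  ᵀ-cong A≋B i j = A≋B j i

  ⊗-expand : ∀ (A B C D : Matrix v) →
    ((A ⊕ B) ⊗ (C ⊕ D)) ≋ (((A ⊗ C) ⊕ (A ⊗ D)) ⊕ ((B ⊗ C) ⊕ (B ⊗ D)))
  ⊗-expand A B C D = begin
    (A ⊕ B) ⊗ (C ⊕ D)                            ≈⟨ ⊗-distribʳ-⊕ (C ⊕ D) A B ⟩
    (A ⊗ (C ⊕ D)) ⊕ (B ⊗ (C ⊕ D))                ≈⟨ ⊕-cong (⊗-distribˡ-⊕ A C D) (⊗-distribˡ-⊕ B C D) ⟩
    ((A ⊗ C) ⊕ (A ⊗ D)) ⊕ ((B ⊗ C) ⊕ (B ⊗ D))    ∎
    where open SetoidReasoning ≋-setoid

  RowSums : Matrix v → ℤ → Set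
  RowSums A r = ∀ i → sumFin v (A i) ≡ r

  RowSums-unique : ∀ {A : Matrix v} {r s} → Fin v → RowSums A r → RowSums A s → r ≡ s
  RowSums-unique i Ar As = trans (sym (Ar i)) (As i)

  RowSums-cong : ∀ {A B : Matrix v} {r} → A ≋ B → RowSums A r → RowSums B r
  RowSums-cong A≋B Ar i = trans (sumFin-cong v (λ j → sym (A≋B i j))) (Ar i)

  RowSums-⊕ : ∀ {A B : Matrix v} {r s} → RowSums A r → RowSums B s → RowSums (A ⊕ B) (r + s)
  RowSums-⊕ {A} {B} Ar Bs i = trans (sumFin-distrib-+ v (A i) (B i)) (cong₂ _+_ (Ar i) (Bs i))

  RowSums-· : ∀ c {A : Matrix v} {r} → RowSums A r → RowSums (c · A) (c * r)
  RowSums-· c {A} Ar i = trans (sym (*-distribˡ-sumFin v c (A i))) (cong (c *_) (Ar i))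

  RowSums-⊗ : ∀ {A B : Matrix v} {r s} → RowSums A r → RowSums B s → RowSums (A ⊗ B) (r * s)
  RowSums-⊗ {A} {B} {r} {s} Ar Bs i = begin
    sumFin v (λ j → sumFin v (λ t → A i t * B t j)) ≡⟨ sumFin-comm v v _ ⟩
    sumFin v (λ t → sumFin v (λ j → A i t * B t j)) ≡⟨ sumFin-cong v (λ t → sym (*-distribˡ-sumFin v (A i t) (B t))) ⟩
    sumFin v (λ t → A i t * sumFin v (B t))         ≡⟨ sumFin-cong v (λ t → cong (A i t *_) (Bs t)) ⟩
    sumFin v (λ t → A i t * s)                      ≡⟨ sym (*-distribʳ-sumFin v s (A i)) ⟩
    sumFin v (A i) * s                              ≡⟨ cong (_* s) (Ar i) ⟩
    r * s                                           ∎
    where open ≡-Reasoning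

  RowSums-I : RowSums (I v) (+ 1)
  RowSums-I i = trans (sumFin-cong v (λ t → sym (*-identityʳ (I v i t)))) (sumFin-I-* v (λ _ → + 1) i)

  RowSums-J : RowSums (J v) (+ v)
  RowSums-J i = trans (sumFin-const v (+ 1)) (*-identityʳ (+ v))

  ⊗-J : ∀ {A : Matrix v} {r} → RowSums A r → (A ⊗ J v) ≋ (r · J v)
  ⊗-J {A} {r} Ar i j = begin
    sumFin v (λ t → A i t * + 1) ≡⟨ sumFin-cong v (λ t → *-identityʳ (A i t)) ⟩
    sumFin v (A i)               ≡⟨ Ar i ⟩
    r                            ≡⟨ sym (*-identityʳ r) ⟩
    r * + 1                      ∎
    where open ≡-Reasoning

  J-⊗ : ∀ {A : Matrix v} {r} → RowSums (A ᵀ) r → (J v ⊗ A) ≋ (r · J v)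
  J-⊗ {A} {r} Aᵀr i j = begin
    sumFin v (λ t → + 1 * A t j) ≡⟨ sumFin-cong v (λ t → *-identityˡ (A t j)) ⟩
    sumFin v (λ t → A t j)       ≡⟨ Aᵀr j ⟩
    r                            ≡⟨ sym (*-identityʳ r) ⟩
    r * + 1                      ∎
    where open ≡-Reasoning

  infix 6 _·I+_·J

  _·I+_·J : ℤ → ℤ → Matrix v
  x ·I+ y ·J = (x · I v) ⊕ (y · J v)

  RowSums-·I+·J : ∀ x y → RowSums (x ·I+ y ·J) (x + + v * y)
  RowSums-·I+·J x y i =
    trans (RowSums-⊕ (RowSums-· x RowSums-I) (RowSums-· y RowSums-J) i) (x*1+y*v≡x+v*y x y (+ v))
    where
    x*1+y*v≡x+v*y : ∀ x y v → x * + 1 + y * v ≡ x + v * y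
    x*1+y*v≡x+v*y = solve-∀

  ·I+·J-⊗ : ∀ x y {B : Matrix v} {b} → RowSums (B ᵀ) b →
    ((x ·I+ y ·J) ⊗ B) ≋ ((x · B) ⊕ ((y * b) · J v))
  ·I+·J-⊗ x y {B} {b} Bᵀb = begin
    ((x · I v) ⊕ (y · J v)) ⊗ B              ≈⟨ ⊗-distribʳ-⊕ B (x · I v) (y · J v) ⟩
    ((x · I v) ⊗ B) ⊕ ((y · J v) ⊗ B)        ≈⟨ ⊕-cong (·-⊗-assoc x (I v) B) (·-⊗-assoc y (J v) B) ⟩
    (x · (I v ⊗ B)) ⊕ (y · (J v ⊗ B))        ≈⟨ ⊕-cong (·-cong x (⊗-identityˡ B)) (·-cong y (J-⊗ Bᵀb)) ⟩
    (x · B) ⊕ (y · (b · J v))                ≈⟨ ⊕-congˡ (x · B) (·-assoc y b (J v)) ⟩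
    (x · B) ⊕ ((y * b) · J v)                ∎
    where open SetoidReasoning ≋-setoid

  gram : Matrix v → Matrix v
  gram A = A ⊗ (A ᵀ)

  gram-⊕ : ∀ (A B : Matrix v) →
    gram (A ⊕ B) ≋ ((gram A ⊕ gram B) ⊕ ((A ⊗ (B ᵀ)) ⊕ ((A ⊗ (B ᵀ)) ᵀ)))
  gram-⊕ A B = begin
    (A ⊕ B) ⊗ ((A ᵀ) ⊕ (B ᵀ))
      ≈⟨ ⊗-expand A B (A ᵀ) (B ᵀ) ⟩
    (gram A ⊕ (A ⊗ (B ᵀ))) ⊕ ((B ⊗ (A ᵀ)) ⊕ gram B)
      ≈⟨ ⊕-congˡ (gram A ⊕ (A ⊗ (B ᵀ))) (⊕-congʳ (gram B) (≋-sym (ᵀ-⊗ A (B ᵀ)))) ⟩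
    (gram A ⊕ (A ⊗ (B ᵀ))) ⊕ (((A ⊗ (B ᵀ)) ᵀ) ⊕ gram B)
      ≈⟨ (λ i j → [a+b]+[c+d]≡[a+d]+[b+c] (gram A i j) ((A ⊗ (B ᵀ)) i j) ((A ⊗ (B ᵀ)) j i) (gram B i j)) ⟩
    (gram A ⊕ gram B) ⊕ ((A ⊗ (B ᵀ)) ⊕ ((A ⊗ (B ᵀ)) ᵀ))
      ∎
    where
    open SetoidReasoning ≋-setoid
    [a+b]+[c+d]≡[a+d]+[b+c] : ∀ a b c d → (a + b) + (c + d) ≡ (a + d) + (b + c)
    [a+b]+[c+d]≡[a+d]+[b+c] = solve-∀

  gram-⊕I : ∀ (A : Matrix v) → gram (A ⊕ I v) ≋ ((gram A ⊕ (A ⊕ (A ᵀ))) ⊕ I v)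
  gram-⊕I A = begin
    (A ⊕ I v) ⊗ ((A ᵀ) ⊕ (I v ᵀ))
      ≈⟨ ⊗-expand A (I v) (A ᵀ) (I v ᵀ) ⟩
    (gram A ⊕ (A ⊗ (I v ᵀ))) ⊕ ((I v ⊗ (A ᵀ)) ⊕ (I v ⊗ (I v ᵀ)))
      ≈⟨ ⊕-cong (⊕-congˡ (gram A) A⊗Iᵀ≋A) (⊕-cong (⊗-identityˡ (A ᵀ)) I⊗Iᵀ≋I) ⟩
    (gram A ⊕ A) ⊕ ((A ᵀ) ⊕ I v)
      ≈⟨ (λ i j → [a+b]+[c+d]≡[a+[b+c]]+d (gram A i j) (A i j) (A j i) (I v i j)) ⟩
    (gram A ⊕ (A ⊕ (A ᵀ))) ⊕ I v
      ∎
    where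
    open SetoidReasoning ≋-setoid
    A⊗Iᵀ≋A : (A ⊗ (I v ᵀ)) ≋ A
    A⊗Iᵀ≋A = ≋-trans (⊗-congˡ A Iᵀ≋I) (⊗-identityʳ A)
    I⊗Iᵀ≋I : (I v ⊗ (I v ᵀ)) ≋ I v
    I⊗Iᵀ≋I = ≋-trans (⊗-identityˡ (I v ᵀ)) Iᵀ≋I
    [a+b]+[c+d]≡[a+[b+c]]+d : ∀ a b c d → (a + b) + (c + d) ≡ (a + (b + c)) + d
    [a+b]+[c+d]≡[a+[b+c]]+d = solve-∀

  ·I+·J-zero-diagonal : ∀ {B : Matrix v} {d c s} → Fin v → B ≋ (d ·I+ c ·J) →
    (∀ i → B i i ≡ + 0) → RowSums B s → c * (+ v - + 1) ≡ s × d ≡ - c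
  ·I+·J-zero-diagonal {B} {d} {c} {s} i B≋dI+cJ Bᵢᵢ≡0 Bs = c[v-1]≡s , d≡-c
    where
    open ≡-Reasoning
    d+c≡0 : d + c ≡ + 0
    d+c≡0 = begin
      d + c                   ≡⟨ cong₂ _+_ (sym (*-identityʳ d)) (sym (*-identityʳ c)) ⟩
      d * + 1 + c * + 1       ≡⟨ cong (λ δ → d * δ + c * + 1) (sym (I-diag v i)) ⟩
      d * I v i i + c * + 1   ≡⟨ sym (B≋dI+cJ i i) ⟩
      B i i                   ≡⟨ Bᵢᵢ≡0 i ⟩
      + 0                     ∎
    d+v*c≡s : d + + v * c ≡ s
    d+v*c≡s = RowSums-unique i (RowSums-cong (≋-sym B≋dI+cJ) (RowSums-·I+·J d c)) Bs
    c[v-1]≡s : c * (+ v - + 1) ≡ s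
    c[v-1]≡s = begin
      c * (+ v - + 1)               ≡⟨ c[v-1]≡[d+v*c]-[d+c] c d (+ v) ⟩
      (d + + v * c) - (d + c)       ≡⟨ cong₂ _-_ d+v*c≡s d+c≡0 ⟩
      s - + 0                       ≡⟨ +-identityʳ s ⟩
      s                             ∎
      where
      c[v-1]≡[d+v*c]-[d+c] : ∀ c d v → c * (v - + 1) ≡ (d + v * c) - (d + c)
      c[v-1]≡[d+v*c]-[d+c] = solve-∀
    d≡-c : d ≡ - c
    d≡-c = begin
      d               ≡⟨ d≡[d+c]-c d c ⟩
      (d + c) - c     ≡⟨ cong (_- c) d+c≡0 ⟩
      + 0 - c         ≡⟨ +-identityˡ (- c) ⟩
      - c             ∎
      where
      d≡[d+c]-c : ∀ d c → d ≡ (d + c) - c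
      d≡[d+c]-c = solve-∀

ZeroOne : ℤ → Set
ZeroOne x = (x ≡ + 0) ⊎ (x ≡ + 1)

zeroOne-+⇒*≡0 : ∀ {x y} → ZeroOne x → ZeroOne y → ZeroOne (x + y) → x * y ≡ + 0
zeroOne-+⇒*≡0 (inj₁ refl) _           _        = refl
zeroOne-+⇒*≡0 (inj₂ refl) (inj₁ refl) _        = refl
zeroOne-+⇒*≡0 (inj₂ refl) (inj₂ refl) (inj₁ ())
zeroOne-+⇒*≡0 (inj₂ refl) (inj₂ refl) (inj₂ ())

⊗ᵀ-diagonal-zero : ∀ {v} {A B : Matrix v} →
  (∀ i j → ZeroOne (A i j)) → (∀ i j → ZeroOne (B i j)) → (∀ i j → ZeroOne ((A ⊕ B) i j)) →
  ∀ i → (A ⊗ (B ᵀ)) i i ≡ + 0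
⊗ᵀ-diagonal-zero {v} A01 B01 A⊕B01 i =
  trans (sumFin-cong v (λ t → zeroOne-+⇒*≡0 (A01 i t) (B01 i t) (A⊕B01 i t))) (sumFin-zero v)

*-cancelʳ-pred : ∀ {v} → 2 ≤ v → ∀ a b → a * (+ v - + 1) ≡ b * (+ v - + 1) → a ≡ b
*-cancelʳ-pred {suc (suc n)} (s≤s (s≤s z≤n)) a b = *-cancelʳ-≡ a b (+ suc n)

module _ {v k l : ℕ} {M : Matrix v} (D : IsSymmetricDesign v k l M) where
  open IsSymmetricDesign D

  k*k≡k-l+v*l : Fin v → + k * + k ≡ (+ k - + l) + + v * + l
  k*k≡k-l+v*l i =
    RowSums-unique i (RowSums-⊗ rowSum colSum) (RowSums-cong (≋-sym MMᵀ) (RowSums-·I+·J (+ k - + l) (+ l)))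

module _ {v k₁ l₁ k₂ l₂ : ℕ} {M₁ M₂ : Matrix v}
         (D₁ : IsSymmetricDesign v k₁ l₁ M₁) (D₂ : IsSymmetricDesign v k₂ l₂ M₂) where
  open IsSymmetricDesign

  private
    x₁ x₂ : ℤ
    x₁ = + k₁ - + l₁
    x₂ = + k₂ - + l₂

  gram-⊗ᵀ : gram (M₁ ⊗ (M₂ ᵀ)) ≋ ((x₁ * x₂) ·I+ (+ v * + l₁ * + l₂ + + l₂ * x₁ + + l₁ * x₂) ·J)
  gram-⊗ᵀ = begin
    (M₁ ⊗ (M₂ ᵀ)) ⊗ ((M₁ ⊗ (M₂ ᵀ)) ᵀ)
      ≈⟨ ⊗-congˡ (M₁ ⊗ (M₂ ᵀ)) (ᵀ-⊗ M₁ (M₂ ᵀ)) ⟩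
    (M₁ ⊗ (M₂ ᵀ)) ⊗ (M₂ ⊗ (M₁ ᵀ))
      ≈⟨ ⊗-assoc M₁ (M₂ ᵀ) (M₂ ⊗ (M₁ ᵀ)) ⟩
    M₁ ⊗ ((M₂ ᵀ) ⊗ (M₂ ⊗ (M₁ ᵀ)))
      ≈⟨ ⊗-congˡ M₁ (≋-sym (⊗-assoc (M₂ ᵀ) M₂ (M₁ ᵀ))) ⟩
    M₁ ⊗ (((M₂ ᵀ) ⊗ M₂) ⊗ (M₁ ᵀ))
      ≈⟨ ⊗-congˡ M₁ (⊗-congʳ (M₁ ᵀ) (MᵀM D₂)) ⟩
    M₁ ⊗ ((x₂ ·I+ + l₂ ·J) ⊗ (M₁ ᵀ))
      ≈⟨ ⊗-congˡ M₁ (·I+·J-⊗ x₂ (+ l₂) (rowSum D₁)) ⟩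
    M₁ ⊗ ((x₂ · (M₁ ᵀ)) ⊕ ((+ l₂ * + k₁) · J v))
      ≈⟨ ⊗-distribˡ-⊕ M₁ (x₂ · (M₁ ᵀ)) ((+ l₂ * + k₁) · J v) ⟩
    (M₁ ⊗ (x₂ · (M₁ ᵀ))) ⊕ (M₁ ⊗ ((+ l₂ * + k₁) · J v))
      ≈⟨ ⊕-cong (⊗-·-comm x₂ M₁ (M₁ ᵀ)) (⊗-·-comm (+ l₂ * + k₁) M₁ (J v)) ⟩
    (x₂ · gram M₁) ⊕ ((+ l₂ * + k₁) · (M₁ ⊗ J v))
      ≈⟨ ⊕-cong (·-cong x₂ (MMᵀ D₁)) (·-cong (+ l₂ * + k₁) (⊗-J (rowSum D₁))) ⟩
    (x₂ · (x₁ ·I+ + l₁ ·J)) ⊕ ((+ l₂ * + k₁) · ((+ k₁) · J v))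
      ≈⟨ collect ⟩
    (x₁ * x₂) ·I+ (+ v * + l₁ * + l₂ + + l₂ * x₁ + + l₁ * x₂) ·J
      ∎
    where
    open SetoidReasoning ≋-setoid
    collect : ((x₂ · (x₁ ·I+ + l₁ ·J)) ⊕ ((+ l₂ * + k₁) · ((+ k₁) · J v))) ≋
              ((x₁ * x₂) ·I+ (+ v * + l₁ * + l₂ + + l₂ * x₁ + + l₁ * x₂) ·J)
    collect i j =
      trans (expand x₁ x₂ (I v i j) (+ l₁) (+ l₂) (+ k₁))
      (trans (cong (λ K → x₁ * x₂ * I v i j + (+ l₂ * K + x₂ * + l₁) * + 1) (k*k≡k-l+v*l D₁ i))
             (regroup x₁ x₂ (I v i j) (+ l₁) (+ l₂) (+ v)))
      where
      expand : ∀ x₁ x₂ δ l₁ l₂ k₁ → x₂ * (x₁ * δ + l₁ * + 1) + l₂ * k₁ * (k₁ * + 1)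
                                   ≡ x₁ * x₂ * δ + (l₂ * (k₁ * k₁) + x₂ * l₁) * + 1
      expand = solve-∀
      regroup : ∀ x₁ x₂ δ l₁ l₂ v → x₁ * x₂ * δ + (l₂ * (x₁ + v * l₁) + x₂ * l₁) * + 1
                                   ≡ x₁ * x₂ * δ + (v * l₁ * l₂ + l₂ * x₁ + l₁ * x₂) * + 1
      regroup = solve-∀

module _ {v k l k₁ l₁ k₂ l₂ : ℕ} {M M₁ M₂ : Matrix v}
         (D : IsSymmetricDesign v k l M)
         (D₁ : IsSymmetricDesign v k₁ l₁ M₁) (D₂ : IsSymmetricDesign v k₂ l₂ M₂)
         (M≋M₁⊕M₂ : M ≋ (M₁ ⊕ M₂)) where
  open IsSymmetricDesign

  private
    A : Matrix v
    A = M₁ ⊗ (M₂ ᵀ)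
    d c : ℤ
    d = ((+ k - + l) - (+ k₁ - + l₁)) - (+ k₂ - + l₂)
    c = (+ l - + l₁) - + l₂

  A⊕Aᵀ≋·I+·J : (A ⊕ (A ᵀ)) ≋ (d ·I+ c ·J)
  A⊕Aᵀ≋·I+·J i j = begin
    (A ⊕ (A ᵀ)) i j
      ≡⟨ b≡[a+b]-a (gram M₁ i j + gram M₂ i j) ((A ⊕ (A ᵀ)) i j) ⟩
    ((gram M₁ i j + gram M₂ i j) + (A ⊕ (A ᵀ)) i j) - (gram M₁ i j + gram M₂ i j)
      ≡⟨ cong (_- (gram M₁ i j + gram M₂ i j)) (sym (gram-M≋ i j)) ⟩
    gram M i j - (gram M₁ i j + gram M₂ i j)
      ≡⟨ cong₂ _-_ (MMᵀ D i j) (cong₂ _+_ (MMᵀ D₁ i j) (MMᵀ D₂ i j)) ⟩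
    (x * δ + + l * + 1) - ((x₁ * δ + + l₁ * + 1) + (x₂ * δ + + l₂ * + 1))
      ≡⟨ collect x x₁ x₂ δ (+ l) (+ l₁) (+ l₂) ⟩
    ((x - x₁) - x₂) * δ + ((+ l - + l₁) - + l₂) * + 1
      ∎
    where
    open ≡-Reasoning
    x x₁ x₂ δ : ℤ
    x  = + k - + l
    x₁ = + k₁ - + l₁
    x₂ = + k₂ - + l₂
    δ  = I v i j
    gram-M≋ : gram M ≋ ((gram M₁ ⊕ gram M₂) ⊕ (A ⊕ (A ᵀ)))
    gram-M≋ = ≋-trans (⊗-cong M≋M₁⊕M₂ (ᵀ-cong M≋M₁⊕M₂)) (gram-⊕ M₁ M₂)
    b≡[a+b]-a : ∀ a b → b ≡ (a + b) - a
    b≡[a+b]-a = solve-∀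
    collect : ∀ x x₁ x₂ δ l l₁ l₂ →
      (x * δ + l * + 1) - ((x₁ * δ + l₁ * + 1) + (x₂ * δ + l₂ * + 1))
        ≡ ((x - x₁) - x₂) * δ + ((l - l₁) - l₂) * + 1
    collect = solve-∀

  A⊕Aᵀ-diagonal-zero : ∀ i → (A ⊕ (A ᵀ)) i i ≡ + 0
  A⊕Aᵀ-diagonal-zero i = cong₂ _+_ Aᵢᵢ≡0 Aᵢᵢ≡0
    where
    Aᵢᵢ≡0 : A i i ≡ + 0
    Aᵢᵢ≡0 = ⊗ᵀ-diagonal-zero (zeroOne D₁) (zeroOne D₂)
              (λ s t → subst ZeroOne (M≋M₁⊕M₂ s t) (zeroOne D s t)) i

  RowSums-A⊕Aᵀ : RowSums (A ⊕ (A ᵀ)) (+ k₁ * + k₂ + + k₂ * + k₁)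
  RowSums-A⊕Aᵀ = RowSums-⊕ (RowSums-⊗ (rowSum D₁) (colSum D₂))
                             (RowSums-cong (≋-sym (ᵀ-⊗ M₁ (M₂ ᵀ))) (RowSums-⊗ (rowSum D₂) (colSum D₁)))

  A⊕Aᵀ≋-α·I+α·J : 2 ≤ v → ∀ α → α * (+ v - + 1) ≡ + 2 * + k₁ * + k₂ →
    (A ⊕ (A ᵀ)) ≋ ((- α) ·I+ α ·J)
  A⊕Aᵀ≋-α·I+α·J 2≤v α α[v-1]≡2k₁k₂ =
    ≋-trans A⊕Aᵀ≋·I+·J (λ i j → cong₂ (λ d′ c′ → d′ * I v i j + c′ * + 1) d≡-α c≡α)
    where
    coefficient-equations : c * (+ v - + 1) ≡ + k₁ * + k₂ + + k₂ * + k₁ × d ≡ - c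
    coefficient-equations =
      ·I+·J-zero-diagonal (fromℕ< 2≤v) A⊕Aᵀ≋·I+·J A⊕Aᵀ-diagonal-zero RowSums-A⊕Aᵀ
    2*a*b≡a*b+b*a : ∀ a b → + 2 * a * b ≡ a * b + b * a
    2*a*b≡a*b+b*a = solve-∀
    c≡α : c ≡ α
    c≡α = *-cancelʳ-pred 2≤v c α
      (trans (proj₁ coefficient-equations) (sym (trans α[v-1]≡2k₁k₂ (2*a*b≡a*b+b*a (+ k₁) (+ k₂)))))
    d≡-α : d ≡ - α
    d≡-α = trans (proj₂ coefficient-equations) (cong -_ c≡α)

proposition4p9 : (v k l k₁ l₁ k₂ l₂ : ℕ) → 2 ≤ v →
    (M M₁ M₂ : Matrix v) →
    IsSymmetricDesign v k l M →
    IsSymmetricDesign v k₁ l₁ M₁ →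
    IsSymmetricDesign v k₂ l₂ M₂ →
    M ≋ (M₁ ⊕ M₂) →
    (α : ℤ) → α * ((+ v) - (+ 1)) ≡ (+ 2) * (+ k₁) * (+ k₂) →
    let Q = (M₁ ⊗ (M₂ ᵀ)) ⊕ I v
        σ = ((+ k₁) - (+ l₁)) * ((+ k₂) - (+ l₂)) - α + (+ 1)
        τ = (+ v) * (+ l₁) * (+ l₂) + (+ l₂) * ((+ k₁) - (+ l₁))
              + (+ l₁) * ((+ k₂) - (+ l₂)) + α
    in (Q ⊗ (Q ᵀ)) ≋ ((σ · I v) ⊕ (τ · J v))
proposition4p9 v k l k₁ l₁ k₂ l₂ 2≤v M M₁ M₂ D D₁ D₂ M≋M₁⊕M₂ α α[v-1]≡2k₁k₂ = begin
  gram (A ⊕ I v)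
    ≈⟨ gram-⊕I A ⟩
  (gram A ⊕ (A ⊕ (A ᵀ))) ⊕ I v
    ≈⟨ ⊕-congʳ (I v) (⊕-cong (gram-⊗ᵀ D₁ D₂) (A⊕Aᵀ≋-α·I+α·J D D₁ D₂ M≋M₁⊕M₂ 2≤v α α[v-1]≡2k₁k₂)) ⟩
  ((x₁ * x₂ ·I+ τ′ ·J) ⊕ ((- α) ·I+ α ·J)) ⊕ I v
    ≈⟨ (λ i j → collect (x₁ * x₂) τ′ α (I v i j)) ⟩
  (x₁ * x₂ - α + + 1) ·I+ (τ′ + α) ·J
    ∎
  where
  open SetoidReasoning ≋-setoid
  A : Matrix v
  A = M₁ ⊗ (M₂ ᵀ)
  x₁ x₂ τ′ : ℤ
  x₁ = + k₁ - + l₁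
  x₂ = + k₂ - + l₂
  τ′ = + v * + l₁ * + l₂ + + l₂ * x₁ + + l₁ * x₂
  collect : ∀ p t α δ →
    (p * δ + t * + 1 + (- α * δ + α * + 1)) + δ ≡ (p - α + + 1) * δ + (t + α) * + 1
  collect = solve-∀
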